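{- Let $m$ be an odd integer and define integers $c_m(n)$ by $$\frac{1}{(1-x)^{m}}\prod_{i=0}^{\infty}\frac{1}{(1-x^{2^{i}})^{m}}=\sum_{n=0}^{\infty}c_{m}(n)x^{n}.$$ Then for every integer $n\ge 1$, $\nu_2(c_m(2n)-c_m(n))=1$.
   Context: $\nu_2(a)$ is the $2$-adic valuation of the integer $a$. -}

module Defs where

open import Data.Nat as ℕ using (ℕ; zero; suc; _∸_; _^_)
open import Data.Nat.Divisibility as ℕD using (_∣?_)
open import Data.Integer as ℤ using (ℤ; +_; -[1+_])
open import Data.Integer.Divisibility as ℤD using ()
open import Data.List using (List; upTo; map; foldr)
open import Data.Product using (_×_)
open import Data.Bool using (if_then_else_)
open import Relation.Nullary using (¬_; does)

-- Formal power series with integer coefficients: n ↦ coefficient of x^n.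
Series : Set
Series = ℕ → ℤ

_⊛_ : Series → Series → Series
(a ⊛ b) n = foldr ℤ._+_ (+ 0) (map (λ k → a k ℤ.* b (n ∸ k)) (upTo (suc n)))

one : Series
one zero    = + 1
one (suc _) = + 0

pow : Series → ℕ → Series
pow s zero    = one
pow s (suc k) = s ⊛ pow s k

-- 1/(1 - x^d) = Σ_{j} x^{d j}   (used only for d ≥ 1)
geom : ℕ → Series
geom d n = if does (d ∣? n) then + 1 else + 0

-- 1 - x^d   (used only for d ≥ 1)
oneMinusX^ : ℕ → Series
oneMinusX^ d zero    = + 1
oneMinusX^ d (suc n) = if (suc n ℕ.≡ᵇ d) then ℤ.- (+ 1) else + 0

-- (1 - x^d)^(-m) for an integer m:
--   m = k ≥ 0   : (1/(1-x^d))^k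
--   m = -(k+1)  : (1-x^d)^(k+1)
invPow : ℕ → ℤ → Series
invPow d (+ k)     = pow (geom d) k
invPow d -[1+ k ]  = pow (oneMinusX^ d) (suc k)

prodUpTo : ℤ → ℕ → Series
prodUpTo m zero    = invPow 1 m
prodUpTo m (suc i) = prodUpTo m i ⊛ invPow (2 ^ suc i) m

-- c_m(n): coefficient of x^n in (1-x)^(-m) ∏_{i≥0} (1-x^(2^i))^(-m).
-- Factors with 2^i > n do not affect the coefficient of x^n, and 2^n > n,
-- so truncating the product at i = n is exact.
c : ℤ → ℕ → ℤ
c m n = (invPow 1 m ⊛ prodUpTo m n) n

ν₂≡ : ℤ → ℕ → Set
ν₂≡ a k = (+ (2 ^ k) ℤD.∣ a) × ¬ (+ (2 ^ suc k) ℤD.∣ a)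

module Submission where

-- Write J = (1 - x)⁻ᵐ, P = ∏ᵢ (1 - x^(2^i))⁻ᵐ and F = J P = Σ cₘ(n) xⁿ, so that P(x) = J(x) P(x²).
-- Since (1 - x)² ≡ (1 + x)² mod 4 and (1 - x)(1 + x) = 1 - x², every odd power J of (1 - x)
-- satisfies (1 - x) J(x)² ≡ (1 + x) J(x²) mod 4, and therefore (1 - x) F(x) ≡ (1 + x) F(x²) mod 4.
-- On coefficients: c(2k+1) ≡ c(2k) + c(k) and c(2k+2) ≡ c(2k+1) + c(k+1) mod 4. Read mod 2 these make
-- c(n) even for n ≥ 1; then c(2k+1) ≡ 2 mod 4 by induction, and c(2n) - c(n) ≡ c(2n-1) ≡ 2 mod 4.
-- The infinite product is reached through its truncations, which are exact up to degree 2^(N+1) - 1.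

open import Data.Nat using (ℕ; _≤_; _*_)
open import Data.Integer using (ℤ; +_; _-_)
open import Data.Integer.Divisibility using (_∣_)
open import Relation.Nullary using (¬_)
open import Defs

open import Level using (0ℓ)
open import Function using (id; _∘_)
open import Function.Bundles using (mk⇔)
open import Data.Bool using (Bool; if_then_else_)
open import Data.Product using (_,_)
open import Data.Sum using (inj₁; inj₂)
open import Data.Nat using (zero; suc; _<_; _^_; s≤s; z≤n)
import Data.Nat as ℕ
import Data.Nat.Properties as ℕ
import Data.Nat.Divisibility as ℕ
open import Data.Nat.Induction using (<-rec)
open import Data.Integer using (0ℤ; -_; _+_; -[1+_]) renaming (_*_ to _·_)
import Data.Integer.Properties as ℤ
import Data.Integer.Divisibility.Signed as Signed
open import Data.Integer.Tactic.RingSolver using (solve-∀)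
open import Data.List using (foldr; applyUpTo)
import Data.List.Properties as LP
open import Relation.Nullary using (contradiction)
open import Relation.Nullary.Decidable using (does-⇔; dec-false; dec-true)
open import Relation.Binary.Core using (Rel)
open import Relation.Binary.Structures using (IsEquivalence)
open import Relation.Binary.Bundles using (Setoid)
open import Relation.Binary.PropositionalEquality
  using (_≡_; refl; sym; trans; cong; cong₂; subst; _≗_; _→-setoid_; module ≡-Reasoning)
import Relation.Binary.Reasoning.Setoid as SetoidReasoning
open import Algebra.Bundles using (CommutativeMonoid)
open import Algebra.Definitions using (Congruent₂)
import Algebra.Properties.CommutativeSemigroup as CommutativeSemigroupProperties

infix 4 _≡_[mod_]

record _≡_[mod_] (a b n : ℤ) : Set where
  constructor congruent
  field divides-difference : n Signed.∣ a - b

module _ {n : ℤ} where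

  ≡⇒≡-mod : ∀ {a b} → a ≡ b → a ≡ b [mod n ]
  ≡⇒≡-mod {a} refl = congruent (Signed.divides 0ℤ (trans (ℤ.+-inverseʳ a) (sym (ℤ.*-zeroˡ n))))

  ≡-mod-refl : ∀ {a} → a ≡ a [mod n ]
  ≡-mod-refl = ≡⇒≡-mod refl

  ≡-mod-sym : ∀ {a b} → a ≡ b [mod n ] → b ≡ a [mod n ]
  ≡-mod-sym {a} {b} (congruent n∣a-b) = congruent (subst (n Signed.∣_) (negate a b) (Signed.∣m⇒∣-m n∣a-b))
    where
    negate : ∀ a b → - (a - b) ≡ b - a
    negate = solve-∀

  ≡-mod-trans : ∀ {a b c} → a ≡ b [mod n ] → b ≡ c [mod n ] → a ≡ c [mod n ]
  ≡-mod-trans {a} {b} {c} (congruent n∣a-b) (congruent n∣b-c) =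
    congruent (subst (n Signed.∣_) (telescope a b c) (Signed.∣m∣n⇒∣m+n n∣a-b n∣b-c))
    where
    telescope : ∀ a b c → (a - b) + (b - c) ≡ a - c
    telescope = solve-∀

  +-cong-mod : ∀ {a b c d} → a ≡ b [mod n ] → c ≡ d [mod n ] → a + c ≡ b + d [mod n ]
  +-cong-mod {a} {b} {c} {d} (congruent n∣a-b) (congruent n∣c-d) =
    congruent (subst (n Signed.∣_) (regroup a b c d) (Signed.∣m∣n⇒∣m+n n∣a-b n∣c-d))
    where
    regroup : ∀ a b c d → (a - b) + (c - d) ≡ (a + c) - (b + d)
    regroup = solve-∀

  *-cong-mod : ∀ {a b c d} → a ≡ b [mod n ] → c ≡ d [mod n ] → a · c ≡ b · d [mod n ]
  *-cong-mod {a} {b} {c} {d} (congruent n∣a-b) (congruent n∣c-d) =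
    congruent (subst (n Signed.∣_) (regroup a b c d)
      (Signed.∣m∣n⇒∣m+n (Signed.∣m⇒∣m*n c n∣a-b) (Signed.∣n⇒∣m*n b n∣c-d)))
    where
    regroup : ∀ a b c d → (a - b) · c + b · (c - d) ≡ a · c - b · d
    regroup = solve-∀

≡-mod-weaken : ∀ {m n a b} → m Signed.∣ n → a ≡ b [mod n ] → a ≡ b [mod m ]
≡-mod-weaken m∣n (congruent n∣a-b) = congruent (Signed.∣-trans m∣n n∣a-b)

≡-mod-scale : ∀ k {n a b} → a ≡ b [mod n ] → k · a ≡ k · b [mod k · n ]
≡-mod-scale k {n} {a} {b} (congruent n∣a-b) =
  congruent (subst (k · n Signed.∣_) (distrib k a b) (Signed.*-monoʳ-∣ k n∣a-b))
  where
  distrib : ∀ k a b → k · (a - b) ≡ k · a - k · b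
  distrib = solve-∀

multiple≡0 : ∀ n x → n · x ≡ 0ℤ [mod n ]
multiple≡0 n x = congruent (Signed.divides x (trans (ℤ.+-identityʳ (n · x)) (ℤ.*-comm n x)))

≡-mod-resp-difference : ∀ {n a b a′ b′} → a - b ≡ a′ - b′ → a ≡ b [mod n ] → a′ ≡ b′ [mod n ]
≡-mod-resp-difference {n} eq (congruent n∣a-b) = congruent (subst (n Signed.∣_) eq n∣a-b)

≡-mod-setoid : ℤ → Setoid _ _
≡-mod-setoid n = record
  { Carrier       = ℤ
  ; _≈_           = _≡_[mod n ]
  ; isEquivalence = record { refl = ≡-mod-refl ; sym = ≡-mod-sym ; trans = ≡-mod-trans }
  }

tail : Series → Series
tail a n = a (suc n)

zeroˢ : Series
zeroˢ _ = 0ℤ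

infixl 6 _⊕_
infixl 7 _⊙_ _•_

_⊕_ : Series → Series → Series
(a ⊕ b) n = a n + b n

_•_ : ℤ → Series → Series
(k • a) n = k · a n

-- The Cauchy product by recursion on the first factor, the form in which its laws are proved by induction.
_⊙_ : Series → Series → Series
(a ⊙ b) zero    = a 0 · b 0
(a ⊙ b) (suc n) = a 0 · b (suc n) + (tail a ⊙ b) n

⊛≗⊙ : ∀ a b → a ⊛ b ≗ a ⊙ b
⊛≗⊙ a b n = trans (cong (foldr _+_ 0ℤ) (LP.map-upTo (λ k → a k · b (n ℕ.∸ k)) (suc n))) (sum-upTo a n)
  where
  sum-upTo : ∀ a n → foldr _+_ 0ℤ (applyUpTo (λ k → a k · b (n ℕ.∸ k)) (suc n)) ≡ (a ⊙ b) n
  sum-upTo a zero    = ℤ.+-identityʳ (a 0 · b 0)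
  sum-upTo a (suc n) = cong (_+_ (a 0 · b (suc n))) (sum-upTo (tail a) n)

⊙-cong : ∀ {a a′ b b′} → a ≗ a′ → b ≗ b′ → a ⊙ b ≗ a′ ⊙ b′
⊙-cong a≗a′ b≗b′ zero    = cong₂ _·_ (a≗a′ 0) (b≗b′ 0)
⊙-cong a≗a′ b≗b′ (suc n) = cong₂ _+_ (cong₂ _·_ (a≗a′ 0) (b≗b′ (suc n))) (⊙-cong (a≗a′ ∘ suc) b≗b′ n)

⊙-zeroˡ : ∀ b → zeroˢ ⊙ b ≗ zeroˢ
⊙-zeroˡ b zero    = ℤ.*-zeroˡ (b 0)
⊙-zeroˡ b (suc n) = cong₂ _+_ (ℤ.*-zeroˡ (b (suc n))) (⊙-zeroˡ b n)

⊙-distribʳ-⊕ : ∀ a a′ b → (a ⊕ a′) ⊙ b ≗ a ⊙ b ⊕ a′ ⊙ b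
⊙-distribʳ-⊕ a a′ b zero    = ℤ.*-distribʳ-+ (b 0) (a 0) (a′ 0)
⊙-distribʳ-⊕ a a′ b (suc n) =
  trans (cong (_+_ ((a 0 + a′ 0) · b (suc n))) (⊙-distribʳ-⊕ (tail a) (tail a′) b n))
        (regroup (a 0) (a′ 0) (b (suc n)) _ _)
  where
  regroup : ∀ x y z u v → (x + y) · z + (u + v) ≡ (x · z + u) + (y · z + v)
  regroup = solve-∀

⊙-•-assoc : ∀ k a b → k • a ⊙ b ≗ k • (a ⊙ b)
⊙-•-assoc k a b zero    = ℤ.*-assoc k (a 0) (b 0)
⊙-•-assoc k a b (suc n) =
  trans (cong (_+_ ((k · a 0) · b (suc n))) (⊙-•-assoc k (tail a) b n))
        (regroup k (a 0) (b (suc n)) _)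
  where
  regroup : ∀ k x z u → (k · x) · z + k · u ≡ k · (x · z + u)
  regroup = solve-∀

⊙-unfoldʳ : ∀ a b n → (a ⊙ b) (suc n) ≡ b 0 · a (suc n) + (a ⊙ tail b) n
⊙-unfoldʳ a b zero    = regroup (a 0) (a 1) (b 0) (b 1)
  where
  regroup : ∀ a₀ a₁ b₀ b₁ → a₀ · b₁ + a₁ · b₀ ≡ b₀ · a₁ + a₀ · b₁
  regroup = solve-∀
⊙-unfoldʳ a b (suc n) =
  trans (cong (_+_ (a 0 · b (suc (suc n)))) (⊙-unfoldʳ (tail a) b n)) (regroup (a 0) (b 0) _ _ _)
  where
  regroup : ∀ a₀ b₀ x y z → a₀ · x + (b₀ · y + z) ≡ b₀ · y + (a₀ · x + z)
  regroup = solve-∀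

⊙-comm : ∀ a b → a ⊙ b ≗ b ⊙ a
⊙-comm a b zero    = ℤ.*-comm (a 0) (b 0)
⊙-comm a b (suc n) = trans (cong (_+_ (a 0 · b (suc n))) (⊙-comm (tail a) b n)) (sym (⊙-unfoldʳ b a n))

⊙-assoc : ∀ a b c → (a ⊙ b) ⊙ c ≗ a ⊙ (b ⊙ c)
⊙-assoc a b c zero    = ℤ.*-assoc (a 0) (b 0) (c 0)
⊙-assoc a b c (suc n) =
  trans (cong (_+_ ((a 0 · b 0) · c (suc n)))
          (trans (⊙-distribʳ-⊕ (a 0 • tail b) (tail a ⊙ b) c n)
                 (cong₂ _+_ (⊙-•-assoc (a 0) (tail b) c n) (⊙-assoc (tail a) b c n))))
        (regroup (a 0) (b 0) (c (suc n)) _ _)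
  where
  regroup : ∀ a₀ b₀ c₁ x z → (a₀ · b₀) · c₁ + (a₀ · x + z) ≡ a₀ · (b₀ · c₁ + x) + z
  regroup = solve-∀

⊙-identityˡ : ∀ b → one ⊙ b ≗ b
⊙-identityˡ b zero    = ℤ.*-identityˡ (b 0)
⊙-identityˡ b (suc n) =
  trans (cong₂ _+_ (ℤ.*-identityˡ (b (suc n))) (⊙-zeroˡ b n))
        (ℤ.+-identityʳ (b (suc n)))

⊙-constˡ : ∀ a b → tail a ≗ zeroˢ → a ⊙ b ≗ a 0 • b
⊙-constˡ a b tail≗0 zero    = refl
⊙-constˡ a b tail≗0 (suc n) =
  trans (cong (_+_ (a 0 · b (suc n))) (trans (⊙-cong tail≗0 (λ _ → refl) n) (⊙-zeroˡ b n)))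
        (ℤ.+-identityʳ _)

⊙-linearˡ : ∀ a b → tail (tail a) ≗ zeroˢ → ∀ n → (a ⊙ b) (suc n) ≡ a 0 · b (suc n) + a 1 · b n
⊙-linearˡ a b tail²≗0 n = cong (_+_ (a 0 · b (suc n))) (⊙-constˡ (tail a) b tail²≗0 n)

infix 4 _≋_[mod_]

record _≋_[mod_] (a b : Series) (n : ℤ) : Set where
  constructor coefficientwise
  field coefficient : ∀ k → a k ≡ b k [mod n ]

open _≋_[mod_]

⊙-cong-mod : ∀ {n a a′ b b′} → a ≋ a′ [mod n ] → b ≋ b′ [mod n ] → a ⊙ b ≋ a′ ⊙ b′ [mod n ]
⊙-cong-mod {n} {b = b} {b′} (coefficientwise a≡a′) (coefficientwise b≡b′) = coefficientwise (at a≡a′)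
  where
  at : ∀ {a a′} → (∀ k → a k ≡ a′ k [mod n ]) → ∀ k → (a ⊙ b) k ≡ (a′ ⊙ b′) k [mod n ]
  at a≡a′ zero    = *-cong-mod (a≡a′ 0) (b≡b′ 0)
  at a≡a′ (suc k) = +-cong-mod (*-cong-mod (a≡a′ 0) (b≡b′ (suc k))) (at (a≡a′ ∘ suc) k)

infix 4 _≗[≤_]_

_≗[≤_]_ : Series → ℕ → Series → Set
a ≗[≤ n ] b = ∀ {k} → k ≤ n → a k ≡ b k

≗[≤]-weaken : ∀ {a b m n} → m ≤ n → a ≗[≤ n ] b → a ≗[≤ m ] b
≗[≤]-weaken m≤n a≗b k≤m = a≗b (ℕ.≤-trans k≤m m≤n)

⊙-cong-≤ : ∀ {n a a′ b b′} → a ≗[≤ n ] a′ → b ≗[≤ n ] b′ → a ⊙ b ≗[≤ n ] a′ ⊙ b′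
⊙-cong-≤ {n} a≗a′ b≗b′ {k} k≤n = at k (≗[≤]-weaken k≤n a≗a′) (≗[≤]-weaken k≤n b≗b′)
  where
  at : ∀ k {a a′ b b′} → a ≗[≤ k ] a′ → b ≗[≤ k ] b′ → (a ⊙ b) k ≡ (a′ ⊙ b′) k
  at zero    a≗a′ b≗b′ = cong₂ _·_ (a≗a′ z≤n) (b≗b′ z≤n)
  at (suc k) a≗a′ b≗b′ =
    cong₂ _+_ (cong₂ _·_ (a≗a′ z≤n) (b≗b′ ℕ.≤-refl))
              (at k (a≗a′ ∘ s≤s) (≗[≤]-weaken (ℕ.n≤1+n k) b≗b′))

-- The substitution x ↦ x²

infix 30 _[x²]

_[x²] : Series → Series
(a [x²]) zero          = a 0
(a [x²]) (suc zero)    = 0ℤ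
(a [x²]) (suc (suc n)) = (tail a [x²]) n

[x²]-cong : ∀ {a b} → a ≗ b → a [x²] ≗ b [x²]
[x²]-cong a≗b zero          = a≗b 0
[x²]-cong a≗b (suc zero)    = refl
[x²]-cong a≗b (suc (suc n)) = [x²]-cong (a≗b ∘ suc) n

[x²]-cong-≤ : ∀ {n a b} → a ≗[≤ n ] b → a [x²] ≗[≤ n ] b [x²]
[x²]-cong-≤ a≗b {zero}        _ = a≗b z≤n
[x²]-cong-≤ a≗b {suc zero}    _ = refl
[x²]-cong-≤ a≗b {suc (suc k)} (s≤s k+1≤n) =
  [x²]-cong-≤ (λ j≤n-1 → a≗b (s≤s j≤n-1)) {k} (ℕ.≤-trans (ℕ.n≤1+n k) k+1≤n)

[x²]-⊕ : ∀ a b → (a ⊕ b) [x²] ≗ a [x²] ⊕ b [x²]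
[x²]-⊕ a b zero          = refl
[x²]-⊕ a b (suc zero)    = refl
[x²]-⊕ a b (suc (suc n)) = [x²]-⊕ (tail a) (tail b) n

[x²]-• : ∀ k a → (k • a) [x²] ≗ k • a [x²]
[x²]-• k a zero          = refl
[x²]-• k a (suc zero)    = sym (ℤ.*-zeroʳ k)
[x²]-• k a (suc (suc n)) = [x²]-• k (tail a) n

[x²]-zero : zeroˢ [x²] ≗ zeroˢ
[x²]-zero zero          = refl
[x²]-zero (suc zero)    = refl
[x²]-zero (suc (suc n)) = [x²]-zero n

[x²]-one : one [x²] ≗ one
[x²]-one zero          = refl
[x²]-one (suc zero)    = refl
[x²]-one (suc (suc n)) = [x²]-zero n

[x²]-⊙ : ∀ a b → (a ⊙ b) [x²] ≗ a [x²] ⊙ b [x²]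
[x²]-⊙ a b zero          = refl
[x²]-⊙ a b (suc zero)    = sym (vanish (a 0) (b 0))
  where
  vanish : ∀ a₀ b₀ → a₀ · 0ℤ + 0ℤ · b₀ ≡ 0ℤ
  vanish = solve-∀
[x²]-⊙ a b (suc (suc n)) = begin
  ((a 0 • tail b ⊕ tail a ⊙ b) [x²]) n             ≡⟨ [x²]-⊕ (a 0 • tail b) (tail a ⊙ b) n ⟩
  ((a 0 • tail b) [x²]) n + ((tail a ⊙ b) [x²]) n
    ≡⟨ cong₂ _+_ ([x²]-• (a 0) (tail b) n) ([x²]-⊙ (tail a) b n) ⟩
  a 0 · (tail b [x²]) n + (tail a [x²] ⊙ b [x²]) n ≡⟨ drop-zero-term (a 0) _ ((b [x²]) (suc n)) _ ⟩
  (a [x²] ⊙ b [x²]) (suc (suc n))                   ∎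
  where
  open ≡-Reasoning
  drop-zero-term : ∀ a₀ x y z → a₀ · x + z ≡ a₀ · x + (0ℤ · y + z)
  drop-zero-term = solve-∀

data Parity : ℕ → Set where
  even : ∀ k → Parity (2 * k)
  odd  : ∀ k → Parity (suc (2 * k))

parity : ∀ n → Parity n
parity zero    = even 0
parity (suc n) with parity n
... | even k = odd k
... | odd k  = subst Parity (ℕ.*-suc 2 k) (even (suc k))

[x²]-even : ∀ a k → (a [x²]) (2 * k) ≡ a k
[x²]-even a zero    = refl
[x²]-even a (suc k) = trans (cong (a [x²]) (ℕ.*-suc 2 k)) ([x²]-even (tail a) k)

[x²]-odd : ∀ a k → (a [x²]) (suc (2 * k)) ≡ 0ℤ
[x²]-odd a zero    = refl
[x²]-odd a (suc k) = trans (cong ((a [x²]) ∘ suc) (ℕ.*-suc 2 k)) ([x²]-odd (tail a) k)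

≗-[x²] : ∀ {a b} → (∀ k → b (2 * k) ≡ a k) → (∀ k → b (suc (2 * k)) ≡ 0ℤ) → b ≗ a [x²]
≗-[x²] {a} even-part odd-part n with parity n
... | even k = trans (even-part k) (sym ([x²]-even a k))
... | odd k  = trans (odd-part k) (sym ([x²]-odd a k))

⊙⇒⊛ : ∀ {a b a′ b′} → a ⊙ b ≗ a′ ⊙ b′ → a ⊛ b ≗ a′ ⊛ b′
⊙⇒⊛ {a} {b} {a′} {b′} eq n = trans (⊛≗⊙ a b n) (trans (eq n) (sym (⊛≗⊙ a′ b′ n)))

⊛-cong : ∀ {a a′ b b′} → a ≗ a′ → b ≗ b′ → a ⊛ b ≗ a′ ⊛ b′
⊛-cong a≗a′ b≗b′ = ⊙⇒⊛ (⊙-cong a≗a′ b≗b′)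

⊛-congˡ : ∀ a {b b′} → b ≗ b′ → a ⊛ b ≗ a ⊛ b′
⊛-congˡ a = ⊛-cong {a = a} λ _ → refl

⊛-congʳ : ∀ b {a a′} → a ≗ a′ → a ⊛ b ≗ a′ ⊛ b
⊛-congʳ b a≗a′ = ⊛-cong {b = b} a≗a′ λ _ → refl

⊛-comm : ∀ a b → a ⊛ b ≗ b ⊛ a
⊛-comm a b = ⊙⇒⊛ (⊙-comm a b)

⊛-assoc : ∀ a b c → (a ⊛ b) ⊛ c ≗ a ⊛ (b ⊛ c)
⊛-assoc a b c = ⊙⇒⊛ λ n → begin
  ((a ⊛ b) ⊙ c) n ≡⟨ ⊙-cong (⊛≗⊙ a b) (λ _ → refl) n ⟩
  ((a ⊙ b) ⊙ c) n ≡⟨ ⊙-assoc a b c n ⟩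
  (a ⊙ (b ⊙ c)) n ≡⟨ ⊙-cong (λ _ → refl) (λ k → sym (⊛≗⊙ b c k)) n ⟩
  (a ⊙ (b ⊛ c)) n ∎
  where open ≡-Reasoning

⊛-identityˡ : ∀ b → one ⊛ b ≗ b
⊛-identityˡ b n = trans (⊛≗⊙ one b n) (⊙-identityˡ b n)

⊛-identityʳ : ∀ b → b ⊛ one ≗ b
⊛-identityʳ b n = trans (⊛-comm b one n) (⊛-identityˡ b n)

⊛-linearˡ : ∀ a b → tail (tail a) ≗ zeroˢ → ∀ n → (a ⊛ b) (suc n) ≡ a 0 · b (suc n) + a 1 · b n
⊛-linearˡ a b tail²≗0 n = trans (⊛≗⊙ a b (suc n)) (⊙-linearˡ a b tail²≗0 n)

[x²]-⊛ : ∀ a b → (a ⊛ b) [x²] ≗ a [x²] ⊛ b [x²]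
[x²]-⊛ a b n = trans ([x²]-cong (⊛≗⊙ a b) n) (trans ([x²]-⊙ a b n) (sym (⊛≗⊙ (a [x²]) (b [x²]) n)))

≗⇒≋ : ∀ {n a b} → a ≗ b → a ≋ b [mod n ]
≗⇒≋ a≗b = coefficientwise λ k → ≡⇒≡-mod (a≗b k)

⊛-cong-mod : ∀ {n a a′ b b′} → a ≋ a′ [mod n ] → b ≋ b′ [mod n ] → a ⊛ b ≋ a′ ⊛ b′ [mod n ]
⊛-cong-mod {a = a} {a′} {b} {b′} a≋a′ b≋b′ = coefficientwise λ k →
  ≡-mod-trans (≡⇒≡-mod (⊛≗⊙ a b k))
    (≡-mod-trans (coefficient (⊙-cong-mod a≋a′ b≋b′) k) (≡⇒≡-mod (sym (⊛≗⊙ a′ b′ k))))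

⊛-cong-≤ : ∀ {n a a′ b b′} → a ≗[≤ n ] a′ → b ≗[≤ n ] b′ → a ⊛ b ≗[≤ n ] a′ ⊛ b′
⊛-cong-≤ {a = a} {a′} {b} {b′} a≗a′ b≗b′ {k} k≤n =
  trans (⊛≗⊙ a b k) (trans (⊙-cong-≤ a≗a′ b≗b′ k≤n) (sym (⊛≗⊙ a′ b′ k)))

⊛-congˡ-mod : ∀ a {n b b′} → b ≋ b′ [mod n ] → a ⊛ b ≋ a ⊛ b′ [mod n ]
⊛-congˡ-mod a = ⊛-cong-mod {a = a} (≗⇒≋ λ _ → refl)

⊛-congʳ-mod : ∀ b {n a a′} → a ≋ a′ [mod n ] → a ⊛ b ≋ a′ ⊛ b [mod n ]
⊛-congʳ-mod b a≋a′ = ⊛-cong-mod {b = b} a≋a′ (≗⇒≋ λ _ → refl)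

≋-setoid : ℤ → Setoid _ _
≋-setoid n = record
  { Carrier       = Series
  ; _≈_           = _≋_[mod n ]
  ; isEquivalence = record
    { refl  = coefficientwise λ _ → ≡-mod-refl
    ; sym   = λ a≋b → coefficientwise λ k → ≡-mod-sym (coefficient a≋b k)
    ; trans = λ a≋b b≋c → coefficientwise λ k → ≡-mod-trans (coefficient a≋b k) (coefficient b≋c k)
    }
  }

module ≋-Reasoning (n : ℤ) = SetoidReasoning (≋-setoid n)

module _ (_≈_ : Rel Series 0ℓ) (isEquivalence : IsEquivalence _≈_)
         (≗⇒≈ : ∀ {a b} → a ≗ b → a ≈ b) (⊛-cong-≈ : Congruent₂ _≈_ _⊛_) where

  ⊛-commutativeMonoidOver : CommutativeMonoid 0ℓ 0ℓ
  ⊛-commutativeMonoidOver = record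
    { Carrier             = Series
    ; _≈_                 = _≈_
    ; _∙_                 = _⊛_
    ; ε                   = one
    ; isCommutativeMonoid = record
      { isMonoid = record
        { isSemigroup = record
          { isMagma = record { isEquivalence = isEquivalence ; ∙-cong = ⊛-cong-≈ }
          ; assoc   = λ a b c → ≗⇒≈ (⊛-assoc a b c)
          }
        ; identity = (λ a → ≗⇒≈ (⊛-identityˡ a)) , (λ a → ≗⇒≈ (⊛-identityʳ a))
        }
      ; comm = λ a b → ≗⇒≈ (⊛-comm a b)
      }
    }

⊛-commutativeMonoid : CommutativeMonoid 0ℓ 0ℓ
⊛-commutativeMonoid = ⊛-commutativeMonoidOver _≗_ (Setoid.isEquivalence (ℕ →-setoid ℤ)) id ⊛-cong

module ≗-Reasoning = SetoidReasoning (CommutativeMonoid.setoid ⊛-commutativeMonoid)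

⊛-commutativeMonoid-mod : ℤ → CommutativeMonoid 0ℓ 0ℓ
⊛-commutativeMonoid-mod n =
  ⊛-commutativeMonoidOver _≋_[mod n ] (Setoid.isEquivalence (≋-setoid n)) ≗⇒≋ ⊛-cong-mod

-- The factors (1 - xᵈ)⁻ᵐ and the truncated products

if-cong : ∀ {A : Set} {b b′ : Bool} (x y : A) → b ≡ b′ → (if b then x else y) ≡ (if b′ then x else y)
if-cong x y = cong (λ b → if b then x else y)

geom-[x²] : ∀ d → geom (2 * d) ≗ geom d [x²]
geom-[x²] d = ≗-[x²] even-part odd-part
  where
  even-part : ∀ k → geom (2 * d) (2 * k) ≡ geom d k
  even-part k = if-cong (+ 1) (+ 0)
    (does-⇔ (mk⇔ (ℕ.*-cancelˡ-∣ 2) (ℕ.*-monoʳ-∣ 2)) ((2 * d) ℕ.∣? (2 * k)) (d ℕ.∣? k))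
  odd-part : ∀ k → geom (2 * d) (suc (2 * k)) ≡ 0ℤ
  odd-part k = if-cong (+ 1) (+ 0) (dec-false ((2 * d) ℕ.∣? suc (2 * k)) 2d∤1+2k)
    where
    2d∤1+2k : ¬ (2 * d ℕ.∣ suc (2 * k))
    2d∤1+2k (ℕ.divides q 1+2k≡q*2d) = ℕ.even≢odd (d * q) k (sym (begin
      suc (2 * k) ≡⟨ 1+2k≡q*2d ⟩
      q * (2 * d) ≡⟨ ℕ.*-comm q (2 * d) ⟩
      2 * d * q   ≡⟨ ℕ.*-assoc 2 d q ⟩
      2 * (d * q) ∎))
      where open ≡-Reasoning

oneMinusX^-[x²] : ∀ d → oneMinusX^ (2 * d) ≗ oneMinusX^ d [x²]
oneMinusX^-[x²] d = ≗-[x²] even-part odd-part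
  where
  even-part : ∀ k → oneMinusX^ (2 * d) (2 * k) ≡ oneMinusX^ d k
  even-part zero    = refl
  even-part (suc k) = if-cong (- (+ 1)) (+ 0)
    (does-⇔ (mk⇔ (ℕ.*-cancelˡ-≡ (suc k) d 2) (cong (2 *_))) (2 * suc k ℕ.≟ 2 * d) (suc k ℕ.≟ d))
  odd-part : ∀ k → oneMinusX^ (2 * d) (suc (2 * k)) ≡ 0ℤ
  odd-part k = if-cong (- (+ 1)) (+ 0) (dec-false (suc (2 * k) ℕ.≟ 2 * d) (ℕ.even≢odd d k ∘ sym))

pow-cong : ∀ {s t} k → s ≗ t → pow s k ≗ pow t k
pow-cong zero    s≗t = λ _ → refl
pow-cong (suc k) s≗t = ⊛-cong s≗t (pow-cong k s≗t)

[x²]-pow : ∀ s k → pow s k [x²] ≗ pow (s [x²]) k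
[x²]-pow s zero    = [x²]-one
[x²]-pow s (suc k) n = trans ([x²]-⊛ s (pow s k) n) (⊛-congˡ (s [x²]) ([x²]-pow s k) n)

invPow-[x²] : ∀ d m → invPow (2 * d) m ≗ invPow d m [x²]
invPow-[x²] d (+ k) n = trans (pow-cong k (geom-[x²] d) n) (sym ([x²]-pow (geom d) k n))
invPow-[x²] d -[1+ k ] n =
  trans (pow-cong (suc k) (oneMinusX^-[x²] d) n) (sym ([x²]-pow (oneMinusX^ d) (suc k) n))

prodUpTo-suc : ∀ m N → prodUpTo m (suc N) ≗ invPow 1 m ⊛ prodUpTo m N [x²]
prodUpTo-suc m zero    = ⊛-congˡ (invPow 1 m) (invPow-[x²] 1 m)
prodUpTo-suc m (suc N) = begin
  prodUpTo m (suc N) ⊛ invPow (2 * 2 ^ suc N) m   ≈⟨ ∙-cong (prodUpTo-suc m N) (invPow-[x²] (2 ^ suc N) m) ⟩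
  (J ⊛ P [x²]) ⊛ I [x²]                            ≈⟨ assoc J (P [x²]) (I [x²]) ⟩
  J ⊛ (P [x²] ⊛ I [x²])                            ≈⟨ ⊛-congˡ J ([x²]-⊛ P I) ⟨
  J ⊛ (P ⊛ I) [x²]                                 ∎
  where
  open CommutativeMonoid ⊛-commutativeMonoid using (assoc; ∙-cong)
  open ≗-Reasoning
  J = invPow 1 m
  P = prodUpTo m N
  I = invPow (2 ^ suc N) m

geom-≗[≤]-one : ∀ {k d} → k < d → geom d ≗[≤ k ] one
geom-≗[≤]-one {d = d} k<d {zero}  _     = if-cong (+ 1) (+ 0) (dec-true (d ℕ.∣? 0) (d ℕ.∣0))
geom-≗[≤]-one {d = d} k<d {suc j} 1+j≤k = if-cong (+ 1) (+ 0) (dec-false (d ℕ.∣? suc j) d∤1+j)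
  where
  d∤1+j : ¬ (d ℕ.∣ suc j)
  d∤1+j d∣1+j = ℕ.<⇒≱ (ℕ.≤-<-trans 1+j≤k k<d) (ℕ.∣⇒≤ d∣1+j)

oneMinusX^-≗[≤]-one : ∀ {k d} → k < d → oneMinusX^ d ≗[≤ k ] one
oneMinusX^-≗[≤]-one k<d {zero}  _     = refl
oneMinusX^-≗[≤]-one {d = d} k<d {suc j} 1+j≤k =
  if-cong (- (+ 1)) (+ 0) (dec-false (suc j ℕ.≟ d) (ℕ.<⇒≢ (ℕ.≤-<-trans 1+j≤k k<d)))

pow-≗[≤]-one : ∀ {k s} j → s ≗[≤ k ] one → pow s j ≗[≤ k ] one
pow-≗[≤]-one zero    s≗1 _   = refl
pow-≗[≤]-one (suc j) s≗1 i≤k = trans (⊛-cong-≤ s≗1 (pow-≗[≤]-one j s≗1) i≤k) (⊛-identityˡ one _)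

invPow-≗[≤]-one : ∀ {k d} m → k < d → invPow d m ≗[≤ k ] one
invPow-≗[≤]-one (+ j)    k<d = pow-≗[≤]-one j (geom-≗[≤]-one k<d)
invPow-≗[≤]-one -[1+ j ] k<d = pow-≗[≤]-one (suc j) (oneMinusX^-≗[≤]-one k<d)

truncation : ℤ → ℕ → Series
truncation m N = invPow 1 m ⊛ prodUpTo m N

truncation-suc : ∀ m N {k} → k < 2 ^ suc N → truncation m (suc N) k ≡ truncation m N k
truncation-suc m N {k} k<2^[1+N] = begin
  (J ⊛ (P ⊛ I)) k    ≡⟨ ⊛-assoc J P I k ⟨
  ((J ⊛ P) ⊛ I) k    ≡⟨ ⊛-cong-≤ {a = J ⊛ P} (λ _ → refl) (invPow-≗[≤]-one m k<2^[1+N]) ℕ.≤-refl ⟩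
  ((J ⊛ P) ⊛ one) k  ≡⟨ ⊛-identityʳ (J ⊛ P) k ⟩
  (J ⊛ P) k          ∎
  where
  open ≡-Reasoning
  J = invPow 1 m
  P = prodUpTo m N
  I = invPow (2 ^ suc N) m

n<2^n : ∀ n → n < 2 ^ n
n<2^n zero    = s≤s z≤n
n<2^n (suc n) = ℕ.≤-<-trans (n<2^n n) (ℕ.^-monoʳ-< 2 (s≤s (s≤s z≤n)) (ℕ.n<1+n n))

truncation-≡-c : ∀ m {k N} → k ≤ N → truncation m N k ≡ c m k
truncation-≡-c m {N = zero}  z≤n = refl
truncation-≡-c m {N = suc N} k≤1+N with ℕ.m≤n⇒m<n∨m≡n k≤1+N
... | inj₂ refl  = refl
... | inj₁ k<1+N = trans (truncation-suc m N (ℕ.<-trans k<1+N (n<2^n (suc N))))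
                         (truncation-≡-c m (ℕ.s≤s⁻¹ k<1+N))

-- The twisted Frobenius relation

onePlusX : Series
onePlusX zero          = + 1
onePlusX (suc zero)    = + 1
onePlusX (suc (suc _)) = + 0

geom-1 : ∀ n → geom 1 n ≡ + 1
geom-1 n = if-cong (+ 1) (+ 0) (dec-true (1 ℕ.∣? n) (ℕ.1∣ n))

oneMinusX⊛geom : oneMinusX^ 1 ⊛ geom 1 ≗ one
oneMinusX⊛geom zero    = refl
oneMinusX⊛geom (suc n) = trans (⊛-linearˡ (oneMinusX^ 1) (geom 1) (λ _ → refl) n)
                               (cong₂ (λ a b → + 1 · a + - (+ 1) · b) (geom-1 (suc n)) (geom-1 n))

oneMinusX⊛onePlusX : oneMinusX^ 1 ⊛ onePlusX ≗ oneMinusX^ 1 [x²]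
oneMinusX⊛onePlusX zero                = refl
oneMinusX⊛onePlusX (suc zero)          = refl
oneMinusX⊛onePlusX (suc (suc zero))    = refl
oneMinusX⊛onePlusX (suc (suc (suc n))) =
  trans (⊛-linearˡ (oneMinusX^ 1) onePlusX (λ _ → refl) (suc (suc n))) (sym (vanishes n))
  where
  vanishes : ∀ n → (oneMinusX^ 1 [x²]) (suc (suc (suc n))) ≡ 0ℤ
  vanishes zero    = refl
  vanishes (suc n) = [x²]-zero n

oneMinusX²≋onePlusX² : oneMinusX^ 1 ⊛ oneMinusX^ 1 ≋ onePlusX ⊛ onePlusX [mod + 4 ]
oneMinusX²≋onePlusX² = coefficientwise at
  where
  at : ∀ k → (oneMinusX^ 1 ⊛ oneMinusX^ 1) k ≡ (onePlusX ⊛ onePlusX) k [mod + 4 ]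
  at zero                = ≡-mod-refl
  at (suc zero)          = congruent (Signed.divides (- (+ 1)) refl)
  at (suc (suc zero))    = ≡-mod-refl
  at (suc (suc (suc n))) = ≡⇒≡-mod (trans
    (⊛-linearˡ (oneMinusX^ 1) (oneMinusX^ 1) (λ _ → refl) (suc (suc n)))
    (sym (⊛-linearˡ onePlusX onePlusX (λ _ → refl) (suc (suc n)))))

Frobenius : ℤ → Series → Set
Frobenius n w = w ⊛ w ≋ w [x²] [mod n ]

TwistedFrobenius : ℤ → Series → Set
TwistedFrobenius n j = oneMinusX^ 1 ⊛ (j ⊛ j) ≋ onePlusX ⊛ j [x²] [mod n ]

frobenius-inverse : ∀ {n u v} → Frobenius n u → u ⊛ v ≗ one → Frobenius n v
frobenius-inverse {n} {u} {v} frob-u u⊛v≗1 = begin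
  v ⊛ v                             ≈⟨ identityʳ (v ⊛ v) ⟨
  (v ⊛ v) ⊛ one                     ≈⟨ ⊛-congˡ-mod (v ⊛ v) (≗⇒≋ one≗u[x²]⊛v[x²]) ⟩
  (v ⊛ v) ⊛ (u [x²] ⊛ v [x²])       ≈⟨ ⊛-congˡ-mod (v ⊛ v) (⊛-congʳ-mod (v [x²]) frob-u) ⟨
  (v ⊛ v) ⊛ ((u ⊛ u) ⊛ v [x²])      ≈⟨ assoc (v ⊛ v) (u ⊛ u) (v [x²]) ⟨
  ((v ⊛ v) ⊛ (u ⊛ u)) ⊛ v [x²]      ≈⟨ ⊛-congʳ-mod (v [x²]) (comm (v ⊛ v) (u ⊛ u)) ⟩
  ((u ⊛ u) ⊛ (v ⊛ v)) ⊛ v [x²]      ≈⟨ ⊛-congʳ-mod (v [x²]) (interchange u u v v) ⟩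
  ((u ⊛ v) ⊛ (u ⊛ v)) ⊛ v [x²]      ≈⟨ ≗⇒≋ (⊛-congʳ (v [x²]) (⊛-cong u⊛v≗1 u⊛v≗1)) ⟩
  (one ⊛ one) ⊛ v [x²]              ≈⟨ ≗⇒≋ (⊛-congʳ (v [x²]) (⊛-identityˡ one)) ⟩
  one ⊛ v [x²]                      ≈⟨ identityˡ (v [x²]) ⟩
  v [x²]                            ∎
  where
  open CommutativeMonoid (⊛-commutativeMonoid-mod n)
    using (assoc; comm; identityˡ; identityʳ; commutativeSemigroup)
  open CommutativeSemigroupProperties commutativeSemigroup using (interchange)
  open ≋-Reasoning n
  one≗u[x²]⊛v[x²] : one ≗ u [x²] ⊛ v [x²]
  one≗u[x²]⊛v[x²] k = sym (trans (sym ([x²]-⊛ u v k)) (trans ([x²]-cong u⊛v≗1 k) ([x²]-one k)))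

twistedFrobenius-resp : ∀ {n j j′} → j ≗ j′ → TwistedFrobenius n j → TwistedFrobenius n j′
twistedFrobenius-resp {n} {j} {j′} j≗j′ twisted-j = begin
  oneMinusX^ 1 ⊛ (j′ ⊛ j′) ≈⟨ ≗⇒≋ (⊛-congˡ (oneMinusX^ 1) (⊛-cong j≗j′ j≗j′)) ⟨
  oneMinusX^ 1 ⊛ (j ⊛ j)   ≈⟨ twisted-j ⟩
  onePlusX ⊛ j [x²]        ≈⟨ ≗⇒≋ (⊛-congˡ onePlusX ([x²]-cong j≗j′)) ⟩
  onePlusX ⊛ j′ [x²]       ∎
  where open ≋-Reasoning n

twistedFrobenius-⊛ : ∀ {n j w} → TwistedFrobenius n j → Frobenius n w → TwistedFrobenius n (j ⊛ w)
twistedFrobenius-⊛ {n} {j} {w} twisted-j frob-w = begin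
  oneMinusX^ 1 ⊛ ((j ⊛ w) ⊛ (j ⊛ w))       ≈⟨ ⊛-congˡ-mod (oneMinusX^ 1) (interchange j w j w) ⟩
  oneMinusX^ 1 ⊛ ((j ⊛ j) ⊛ (w ⊛ w))       ≈⟨ assoc (oneMinusX^ 1) (j ⊛ j) (w ⊛ w) ⟨
  (oneMinusX^ 1 ⊛ (j ⊛ j)) ⊛ (w ⊛ w)       ≈⟨ ⊛-cong-mod twisted-j frob-w ⟩
  (onePlusX ⊛ j [x²]) ⊛ w [x²]             ≈⟨ assoc onePlusX (j [x²]) (w [x²]) ⟩
  onePlusX ⊛ (j [x²] ⊛ w [x²])             ≈⟨ ≗⇒≋ (⊛-congˡ onePlusX ([x²]-⊛ j w)) ⟨
  onePlusX ⊛ (j ⊛ w) [x²]                  ∎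
  where
  open CommutativeMonoid (⊛-commutativeMonoid-mod n) using (assoc; commutativeSemigroup)
  open CommutativeSemigroupProperties commutativeSemigroup using (interchange)
  open ≋-Reasoning n

twistedFrobenius-oddPow : ∀ {n s} → TwistedFrobenius n s → Frobenius n (s ⊛ s) →
                          ∀ k → TwistedFrobenius n (pow s (suc (2 * k)))
twistedFrobenius-oddPow {s = s} twisted-s frob-s² zero =
  twistedFrobenius-resp (λ k → sym (⊛-identityʳ s k)) twisted-s
twistedFrobenius-oddPow {s = s} twisted-s frob-s² (suc k) =
  twistedFrobenius-resp s¹⁺²ᵏ⊛s²≗s³⁺²ᵏ
    (twistedFrobenius-⊛ (twistedFrobenius-oddPow twisted-s frob-s² k) frob-s²)
  where
  s¹⁺²ᵏ⊛s²≗s³⁺²ᵏ : pow s (suc (2 * k)) ⊛ (s ⊛ s) ≗ pow s (suc (2 * suc k))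
  s¹⁺²ᵏ⊛s²≗s³⁺²ᵏ n = begin
    (pow s (suc (2 * k)) ⊛ (s ⊛ s)) n     ≡⟨ ⊛-comm (pow s (suc (2 * k))) (s ⊛ s) n ⟩
    ((s ⊛ s) ⊛ pow s (suc (2 * k))) n     ≡⟨ ⊛-assoc s s (pow s (suc (2 * k))) n ⟩
    pow s (suc (suc (suc (2 * k)))) n     ≡⟨ cong (λ i → pow s (suc i) n) (ℕ.*-suc 2 k) ⟨
    pow s (suc (2 * suc k)) n             ∎
    where open ≡-Reasoning

twistedFrobenius-oneMinusX : TwistedFrobenius (+ 4) (oneMinusX^ 1)
twistedFrobenius-oneMinusX = begin
  e ⊛ (e ⊛ e)   ≈⟨ ⊛-congˡ-mod e oneMinusX²≋onePlusX² ⟩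
  e ⊛ (p ⊛ p)   ≈⟨ assoc e p p ⟨
  (e ⊛ p) ⊛ p   ≈⟨ comm (e ⊛ p) p ⟩
  p ⊛ (e ⊛ p)   ≈⟨ ≗⇒≋ (⊛-congˡ p oneMinusX⊛onePlusX) ⟩
  p ⊛ e [x²]    ∎
  where
  open CommutativeMonoid (⊛-commutativeMonoid-mod (+ 4)) using (assoc; comm)
  open ≋-Reasoning (+ 4)
  e = oneMinusX^ 1
  p = onePlusX

frobenius-oneMinusX² : Frobenius (+ 4) (oneMinusX^ 1 ⊛ oneMinusX^ 1)
frobenius-oneMinusX² = begin
  (e ⊛ e) ⊛ (e ⊛ e)   ≈⟨ ⊛-congˡ-mod (e ⊛ e) oneMinusX²≋onePlusX² ⟩
  (e ⊛ e) ⊛ (p ⊛ p)   ≈⟨ interchange e e p p ⟩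
  (e ⊛ p) ⊛ (e ⊛ p)   ≈⟨ ≗⇒≋ (⊛-cong oneMinusX⊛onePlusX oneMinusX⊛onePlusX) ⟩
  e [x²] ⊛ e [x²]     ≈⟨ ≗⇒≋ ([x²]-⊛ e e) ⟨
  (e ⊛ e) [x²]        ∎
  where
  open CommutativeMonoid (⊛-commutativeMonoid-mod (+ 4)) using (commutativeSemigroup)
  open CommutativeSemigroupProperties commutativeSemigroup using (interchange)
  open ≋-Reasoning (+ 4)
  e = oneMinusX^ 1
  p = onePlusX

geom≗onePlusX⊛geom[x²] : geom 1 ≗ onePlusX ⊛ geom 1 [x²]
geom≗onePlusX⊛geom[x²] = begin
  g                                ≈⟨ identityʳ g ⟨
  g ⊛ one                          ≈⟨ ⊛-congˡ g [x²]-one ⟨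
  g ⊛ one [x²]                     ≈⟨ ⊛-congˡ g ([x²]-cong oneMinusX⊛geom) ⟨
  g ⊛ (e ⊛ g) [x²]                 ≈⟨ ⊛-congˡ g ([x²]-⊛ e g) ⟩
  g ⊛ (e [x²] ⊛ g [x²])            ≈⟨ ⊛-congˡ g (⊛-congʳ (g [x²]) oneMinusX⊛onePlusX) ⟨
  g ⊛ ((e ⊛ p) ⊛ g [x²])           ≈⟨ ⊛-congˡ g (assoc e p (g [x²])) ⟩
  g ⊛ (e ⊛ (p ⊛ g [x²]))           ≈⟨ assoc g e (p ⊛ g [x²]) ⟨
  (g ⊛ e) ⊛ (p ⊛ g [x²])           ≈⟨ ⊛-congʳ (p ⊛ g [x²]) (comm g e) ⟩
  (e ⊛ g) ⊛ (p ⊛ g [x²])           ≈⟨ ⊛-congʳ (p ⊛ g [x²]) oneMinusX⊛geom ⟩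
  one ⊛ (p ⊛ g [x²])               ≈⟨ identityˡ (p ⊛ g [x²]) ⟩
  p ⊛ g [x²]                       ∎
  where
  open CommutativeMonoid ⊛-commutativeMonoid using (assoc; comm; identityˡ; identityʳ)
  open ≗-Reasoning
  e = oneMinusX^ 1
  p = onePlusX
  g = geom 1

twistedFrobenius-geom : TwistedFrobenius (+ 4) (geom 1)
twistedFrobenius-geom = ≗⇒≋ λ k → begin
  (e ⊛ (g ⊛ g)) k     ≡⟨ ⊛-assoc e g g k ⟨
  ((e ⊛ g) ⊛ g) k     ≡⟨ ⊛-congʳ g oneMinusX⊛geom k ⟩
  (one ⊛ g) k         ≡⟨ ⊛-identityˡ g k ⟩
  g k                 ≡⟨ geom≗onePlusX⊛geom[x²] k ⟩
  (onePlusX ⊛ g [x²]) k ∎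
  where
  open ≡-Reasoning
  e = oneMinusX^ 1
  g = geom 1

frobenius-geom² : Frobenius (+ 4) (geom 1 ⊛ geom 1)
frobenius-geom² = frobenius-inverse frobenius-oneMinusX² λ k → begin
  ((e ⊛ e) ⊛ (g ⊛ g)) k  ≡⟨ interchange e e g g k ⟩
  ((e ⊛ g) ⊛ (e ⊛ g)) k  ≡⟨ ⊛-cong oneMinusX⊛geom oneMinusX⊛geom k ⟩
  (one ⊛ one) k          ≡⟨ ⊛-identityˡ one k ⟩
  one k                  ∎
  where
  open ≡-Reasoning
  open CommutativeSemigroupProperties (CommutativeMonoid.commutativeSemigroup ⊛-commutativeMonoid)
    using (interchange)
  e = oneMinusX^ 1
  g = geom 1

twistedFrobenius-invPow : ∀ m → ¬ (+ 2 ∣ m) → TwistedFrobenius (+ 4) (invPow 1 m)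
twistedFrobenius-invPow (+ k) m-odd with parity k
... | even j = contradiction (ℕ.m∣m*n j) m-odd
... | odd j  = twistedFrobenius-oddPow twistedFrobenius-geom frobenius-geom² j
twistedFrobenius-invPow -[1+ k ] m-odd with parity k
... | even j = twistedFrobenius-oddPow twistedFrobenius-oneMinusX frobenius-oneMinusX² j
... | odd j  = contradiction (subst (2 ℕ.∣_) (ℕ.*-suc 2 j) (ℕ.m∣m*n (suc j))) m-odd

truncation-twisted : ∀ m → ¬ (+ 2 ∣ m) → ∀ M →
  oneMinusX^ 1 ⊛ truncation m (suc M) ≋ onePlusX ⊛ truncation m M [x²] [mod + 4 ]
truncation-twisted m m-odd M = begin
  e ⊛ (J ⊛ prodUpTo m (suc M))     ≈⟨ ≗⇒≋ (⊛-congˡ e (⊛-congˡ J (prodUpTo-suc m M))) ⟩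
  e ⊛ (J ⊛ (J ⊛ P [x²]))           ≈⟨ ⊛-congˡ-mod e (assoc J J (P [x²])) ⟨
  e ⊛ ((J ⊛ J) ⊛ P [x²])           ≈⟨ assoc e (J ⊛ J) (P [x²]) ⟨
  (e ⊛ (J ⊛ J)) ⊛ P [x²]           ≈⟨ ⊛-congʳ-mod (P [x²]) (twistedFrobenius-invPow m m-odd) ⟩
  (onePlusX ⊛ J [x²]) ⊛ P [x²]     ≈⟨ assoc onePlusX (J [x²]) (P [x²]) ⟩
  onePlusX ⊛ (J [x²] ⊛ P [x²])     ≈⟨ ≗⇒≋ (⊛-congˡ onePlusX ([x²]-⊛ J P)) ⟨
  onePlusX ⊛ (J ⊛ P) [x²]          ∎
  where
  open CommutativeMonoid (⊛-commutativeMonoid-mod (+ 4)) using (assoc)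
  open ≋-Reasoning (+ 4)
  e = oneMinusX^ 1
  J = invPow 1 m
  P = prodUpTo m M

c₀≡1 : ∀ m → c m 0 ≡ + 1
c₀≡1 m = ⊛-cong-≤ (invPow-≗[≤]-one m 0<1) (invPow-≗[≤]-one m 0<1) z≤n
  where
  0<1 : 0 < 1
  0<1 = s≤s z≤n

c-recurrence : ∀ m → ¬ (+ 2 ∣ m) → ∀ n →
  c m (suc n) ≡ c m n + ((c m [x²]) (suc n) + (c m [x²]) n) [mod + 4 ]
c-recurrence m m-odd n = ≡-mod-resp-difference (regroup (c m (suc n)) (c m n) (s (suc n)) (s n)) (begin
  + 1 · c m (suc n) + - (+ 1) · c m n                    ≡⟨ lhs ⟨
  (oneMinusX^ 1 ⊛ truncation m (suc (suc n))) (suc n)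
    ≈⟨ coefficient (truncation-twisted m m-odd (suc n)) (suc n) ⟩
  (onePlusX ⊛ truncation m (suc n) [x²]) (suc n)         ≡⟨ rhs ⟩
  + 1 · s (suc n) + + 1 · s n                            ∎)
  where
  s = c m [x²]
  open SetoidReasoning (≡-mod-setoid (+ 4))
  regroup : ∀ a b s₁ s₀ → (+ 1 · a + - (+ 1) · b) - (+ 1 · s₁ + + 1 · s₀) ≡ a - (b + (s₁ + s₀))
  regroup = solve-∀
  lhs : (oneMinusX^ 1 ⊛ truncation m (suc (suc n))) (suc n) ≡ + 1 · c m (suc n) + - (+ 1) · c m n
  lhs = trans (⊛-linearˡ (oneMinusX^ 1) (truncation m (suc (suc n))) (λ _ → refl) n)
              (cong₂ (λ a b → + 1 · a + - (+ 1) · b)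
                     (truncation-≡-c m (ℕ.n≤1+n (suc n))) (truncation-≡-c m (ℕ.m≤n+m n 2)))
  truncation≗c : truncation m (suc n) [x²] ≗[≤ suc n ] s
  truncation≗c = [x²]-cong-≤ (truncation-≡-c m)
  rhs : (onePlusX ⊛ truncation m (suc n) [x²]) (suc n) ≡ + 1 · s (suc n) + + 1 · s n
  rhs = trans (⊛-linearˡ onePlusX (truncation m (suc n) [x²]) (λ _ → refl) n)
              (cong₂ (λ a b → + 1 · a + + 1 · b) (truncation≗c ℕ.≤-refl) (truncation≗c (ℕ.n≤1+n n)))

-- Sequences with (1 - x) C(x) ≡ (1 + x) C(x²) mod 4

module DilationRecurrence (C : Series) (C₀≡1 : C 0 ≡ + 1)
  (recurrence : ∀ n → C (suc n) ≡ C n + ((C [x²]) (suc n) + (C [x²]) n) [mod + 4 ]) where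

  private
    s : Series
    s = C [x²]

  recurrence-mod-2 : ∀ n → C (suc n) ≡ C n + (s (suc n) + s n) [mod + 2 ]
  recurrence-mod-2 n = ≡-mod-weaken (Signed.divides (+ 2) refl) (recurrence n)

  ≡-[x²]-mod-2 : ∀ n → C (suc n) ≡ s (suc n) [mod + 2 ]
  ≡-[x²]-mod-2 zero = begin
    C 1                      ≈⟨ recurrence-mod-2 0 ⟩
    C 0 + (0ℤ + C 0)         ≡⟨ double (C 0) ⟩
    + 2 · C 0                ≈⟨ multiple≡0 (+ 2) (C 0) ⟩
    0ℤ                       ∎
    where
    open SetoidReasoning (≡-mod-setoid (+ 2))
    double : ∀ a → a + (0ℤ + a) ≡ + 2 · a
    double = solve-∀
  ≡-[x²]-mod-2 (suc n) = begin
    C (suc (suc n))                              ≈⟨ recurrence-mod-2 (suc n) ⟩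
    C (suc n) + (s (suc (suc n)) + s (suc n))    ≈⟨ +-cong-mod (≡-[x²]-mod-2 n) ≡-mod-refl ⟩
    s (suc n) + (s (suc (suc n)) + s (suc n))    ≡⟨ regroup (s (suc n)) (s (suc (suc n))) ⟩
    s (suc (suc n)) + + 2 · s (suc n)            ≈⟨ +-cong-mod (≡-mod-refl {a = s (suc (suc n))})
                                                                   (multiple≡0 (+ 2) (s (suc n))) ⟩
    s (suc (suc n)) + 0ℤ                         ≡⟨ ℤ.+-identityʳ _ ⟩
    s (suc (suc n))                              ∎
    where
    open SetoidReasoning (≡-mod-setoid (+ 2))
    regroup : ∀ a b → a + (b + a) ≡ b + + 2 · a
    regroup = solve-∀

  ≡0-mod-2 : ∀ m → 1 ≤ m → C m ≡ 0ℤ [mod + 2 ]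
  ≡0-mod-2 = <-rec (λ m → 1 ≤ m → C m ≡ 0ℤ [mod + 2 ]) step
    where
    step : ∀ m → (∀ {k} → k < m → 1 ≤ k → C k ≡ 0ℤ [mod + 2 ]) → 1 ≤ m → C m ≡ 0ℤ [mod + 2 ]
    step m rec 1≤m with parity m
    ... | odd k        = ≡-mod-trans (≡-[x²]-mod-2 (2 * k)) (≡⇒≡-mod ([x²]-odd C k))
    ... | even (suc k) = ≡-mod-trans (≡-[x²]-mod-2 (k ℕ.+ suc (k ℕ.+ 0)))
                           (≡-mod-trans (≡⇒≡-mod ([x²]-even C (suc k)))
                                        (rec (ℕ.m<m+n (suc k) (s≤s z≤n)) (s≤s z≤n)))

  recurrence-even : ∀ k → C (suc (2 * k)) ≡ C (2 * k) + C k [mod + 4 ]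
  recurrence-even k = ≡-mod-trans (recurrence (2 * k)) (≡⇒≡-mod (cong (_+_ (C (2 * k))) s-values))
    where
    s-values : s (suc (2 * k)) + s (2 * k) ≡ C k
    s-values = trans (cong₂ _+_ ([x²]-odd C k) ([x²]-even C k)) (ℤ.+-identityˡ (C k))

  recurrence-odd : ∀ k → C (suc (suc (2 * k))) ≡ C (suc (2 * k)) + C (suc k) [mod + 4 ]
  recurrence-odd k = ≡-mod-trans (recurrence (suc (2 * k))) (≡⇒≡-mod (cong (_+_ (C (suc (2 * k)))) s-values))
    where
    s-values : s (suc (suc (2 * k))) + s (suc (2 * k)) ≡ C (suc k)
    s-values = trans (cong₂ _+_ ([x²]-even (tail C) k) ([x²]-odd C k)) (ℤ.+-identityʳ (C (suc k)))

  odd-index : ∀ k → C (suc (2 * k)) ≡ + 2 [mod + 4 ]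
  odd-index zero = begin
    C 1            ≈⟨ recurrence-even 0 ⟩
    C 0 + C 0      ≡⟨ cong (λ a → a + a) C₀≡1 ⟩
    + 2            ∎
    where open SetoidReasoning (≡-mod-setoid (+ 4))
  odd-index (suc k) = begin
    C (suc (2 * suc k))                       ≈⟨ recurrence-even (suc k) ⟩
    C (2 * suc k) + C (suc k)                 ≡⟨ cong (λ i → C i + C (suc k)) (ℕ.*-suc 2 k) ⟩
    C (suc (suc (2 * k))) + C (suc k)         ≈⟨ +-cong-mod (recurrence-odd k) ≡-mod-refl ⟩
    C (suc (2 * k)) + C (suc k) + C (suc k)   ≈⟨ +-cong-mod (+-cong-mod (odd-index k) ≡-mod-refl) ≡-mod-refl ⟩
    + 2 + C (suc k) + C (suc k)               ≡⟨ regroup (C (suc k)) ⟩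
    + 2 + + 2 · C (suc k)                     ≈⟨ +-cong-mod (≡-mod-refl {a = + 2}) twice-even≡0 ⟩
    + 2                                       ∎
    where
    open SetoidReasoning (≡-mod-setoid (+ 4))
    regroup : ∀ a → + 2 + a + a ≡ + 2 + + 2 · a
    regroup = solve-∀
    twice-even≡0 : + 2 · C (suc k) ≡ 0ℤ [mod + 4 ]
    twice-even≡0 = ≡-mod-scale (+ 2) (≡0-mod-2 (suc k) (s≤s z≤n))

  doubling : ∀ n → 1 ≤ n → C (2 * n) - C n ≡ + 2 [mod + 4 ]
  doubling (suc i) _ = ≡-mod-resp-difference (regroup (C (2 * suc i)) (C (suc i))) (begin
    C (2 * suc i)                   ≡⟨ cong C (ℕ.*-suc 2 i) ⟩
    C (suc (suc (2 * i)))           ≈⟨ recurrence-odd i ⟩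
    C (suc (2 * i)) + C (suc i)     ≈⟨ +-cong-mod (odd-index i) ≡-mod-refl ⟩
    + 2 + C (suc i)                 ∎)
    where
    open SetoidReasoning (≡-mod-setoid (+ 4))
    regroup : ∀ a b → a - (+ 2 + b) ≡ (a - b) - + 2
    regroup = solve-∀

ν₂≡1 : ∀ {x} → x ≡ + 2 [mod + 4 ] → ν₂≡ x 1
ν₂≡1 {x} (congruent 4∣x-2) = Signed.∣⇒∣ᵤ 2∣x , 4∤x
  where
  2∣x : + 2 Signed.∣ x
  2∣x = subst (+ 2 Signed.∣_) (cancel x)
          (Signed.∣m∣n⇒∣m+n (Signed.∣-trans (Signed.divides (+ 2) refl) 4∣x-2) (Signed.∣-refl {+ 2}))
    where
    cancel : ∀ x → (x - + 2) + + 2 ≡ x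
    cancel = solve-∀
  4∤2 : ¬ (4 ℕ.∣ 2)
  4∤2 4∣2 = ℕ.<⇒≱ (s≤s (s≤s (s≤s z≤n))) (ℕ.∣⇒≤ 4∣2)
  4∤x : ¬ (+ 4 ∣ x)
  4∤x 4∣x = 4∤2 (Signed.∣⇒∣ᵤ (subst (+ 4 Signed.∣_) (difference x)
                                    (Signed.∣m∣n⇒∣m-n (Signed.∣ᵤ⇒∣ {i = x} 4∣x) 4∣x-2)))
    where
    difference : ∀ x → x - (x - + 2) ≡ + 2
    difference = solve-∀

corollary2p5 : (m : ℤ) → ¬ (+ 2 ∣ m) → (n : ℕ) → 1 ≤ n →
    ν₂≡ (c m (2 * n) - c m n) 1
corollary2p5 m m-odd n 1≤n = ν₂≡1 (doubling n 1≤n)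
  where
  open DilationRecurrence (c m) (c₀≡1 m) (c-recurrence m m-odd)
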